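{- Let $\mathcal{L}$ be a $\Sigma$-additive category with products (indexed by the sets $I$ of some fixed class), equipped with a $\Sigma$-summability structure $(S,(\pi_i)_{i\in\mathbb{N}})$, with $S$ made into an endofunctor by $Sh=\langle h\circ\pi_i\rangle_{i}$. For a family $(X_i)_{i\in I}$ let $\varphi=\langle Sp_i\rangle_{i\in I}\in\mathcal{L}(S(\mathbin{\&}_{i\in I}X_i),\mathbin{\&}_{i\in I}SX_i)$. The following are equivalent: (1) for every such family $(X_i)_{i\in I}$, the family $(\mathbin{\&}_{i\in I}\pi_{j,X_i})_{j\in\mathbb{N}}$ in $\mathcal{L}(\mathbin{\&}_{i}SX_i,\mathbin{\&}_{i}X_i)$ is summable; (2) for every such family, $\varphi$ is an isomorphism. Moreover, in that case $\varphi^{ -1}=\langle\mathbin{\&}_{i\in I}\pi_{j,X_i}\rangle_{j\in\mathbb{N}}$ (the witness of the family in (1)).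
   Context: $e\sqsubseteq e'$: if $e$ is defined then $e'$ is defined and equal; $e\simeq e'$: one side defined iff the other is, and then equal. $\Sigma$-monoid: nonempty set with a partial operation $\Sigma$ on families indexed by at most countable sets (families in the domain are summable) such that every one-element family $x$ is summable with sum $x$ and, for every family $(x_a)_{a\in A}$ and partition $(A_i)_{i\in I}$ of $A$ ($I$ at most countable, parts possibly empty), $\sum_{a\in A}x_a\simeq\sum_{i\in I}\sum_{a\in A_i}x_a$. The empty sum is $0$. A $\Sigma$-additive category: hom-sets are $\Sigma$-monoids with $(\sum_b g_b)\circ f\sqsubseteq\sum_b(g_b\circ f)$ and $h\circ(\sum_a f_a)\sqsubseteq\sum_a(h\circ f_a)$. A $\Sigma$-summability structure: a map $S$ on objects and morphisms $\pi_{i,X}\in\mathcal{L}(SX,X)$ such that $(\pi_{i,Y})_i$ is jointly monic; $(f_i)_{i\in\mathbb{N}}$ in $\mathcal{L}(X,Y)$ is summable iff there is $f\in\mathcal{L}(X,SY)$ (then unique, written $\langle f_i\rangle_i$ and called the witness) with $\pi_i\circ f=f_i$ for all $i$; and for any family $(f_a)_{a\in A}$ in $\mathcal{L}(X,SY)$, if $(\pi_i\circ f_a)_{(i,a)\in\mathbb{N}\times A}$ is summable then $(f_a)_a$ is summable. Products: $\mathbin{\&}_{i}X_i$ with projections $p_i$ and tuplings $\langle f_i\rangle_i$; $\mathbin{\&}_i f_i=\langle f_i\circ p_i\rangle_i$. -}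

module Defs where

open import Level using (Level; _⊔_) renaming (suc to lsuc; zero to lzero)
open import Data.Nat using (ℕ)
open import Data.Product using (Σ; _×_; _,_; proj₁; proj₂)
open import Function.Definitions using (Injective)
open import Relation.Binary.PropositionalEquality using (_≡_; refl)

Countable : Set → Set
Countable A = Σ (A → ℕ) (λ f → Injective _≡_ _≡_ f)

ℕ-countable : Countable ℕ
ℕ-countable = (λ n → n) , (λ e → e)

-- The partial sum operation is a (functional) relation
-- "Sum x m" = "the family x is summable with sum m".
-- A partition (A_i)_{i∈I} of A is given by the map q : A → I sending
-- each element to its part; the part A_i is the fibre  Σ A (q a ≡ i).

module _ {ℓ} {M : Set ℓ} (Sum : {A : Set} → (A → M) → M → Set ℓ) where

  IterSum : {A I : Set} → (A → M) → (A → I) → M → Set ℓ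
  IterSum {A} {I} x q m =
    Σ (I → M) (λ y →
      ((i : I) → Sum (λ (a : Σ A (λ a → q a ≡ i)) → x (proj₁ a)) (y i))
      × Sum y m)

record SigmaMonoid {ℓ} (M : Set ℓ) : Set (lsuc ℓ) where
  field
    point : M                             -- nonempty
    Sum : {A : Set} → (A → M) → M → Set ℓ
    Sum-functional : {A : Set} (x : A → M) {m m′ : M} →
                     Sum x m → Sum x m′ → m ≡ m′
    Sum-one : {A : Set} (x : A → M) (a₀ : A) → ((a : A) → a ≡ a₀) →
              Sum x (x a₀)
    Sum-partition : {A I : Set} → Countable A → Countable I →
                    (x : A → M) (q : A → I) (m : M) →
                    (Sum x m → IterSum Sum x q m) × (IterSum Sum x q m → Sum x m)

record Category (o ℓ : Level) : Set (lsuc (o ⊔ ℓ)) where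
  infixr 9 _∘_
  field
    Obj : Set o
    Hom : Obj → Obj → Set ℓ
    id : {X : Obj} → Hom X X
    _∘_ : {X Y Z : Obj} → Hom Y Z → Hom X Y → Hom X Z
    assoc : {W X Y Z : Obj} (h : Hom Y Z) (g : Hom X Y) (f : Hom W X) →
            (h ∘ g) ∘ f ≡ h ∘ (g ∘ f)
    identityˡ : {X Y : Obj} (f : Hom X Y) → id ∘ f ≡ f
    identityʳ : {X Y : Obj} (f : Hom X Y) → f ∘ id ≡ f

  IsIso : {X Y : Obj} → Hom X Y → Set ℓ
  IsIso {X} {Y} f = Σ (Hom Y X) (λ g → (g ∘ f ≡ id) × (f ∘ g ≡ id))

record SigmaAdditive {o ℓ} (C : Category o ℓ) : Set (lsuc (o ⊔ ℓ)) where
  open Category C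
  field
    homΣ : (X Y : Obj) → SigmaMonoid (Hom X Y)

  Sum : {X Y : Obj} {A : Set} → (A → Hom X Y) → Hom X Y → Set ℓ
  Sum {X} {Y} = SigmaMonoid.Sum (homΣ X Y)

  Summable : {X Y : Obj} {A : Set} → (A → Hom X Y) → Set ℓ
  Summable {X} {Y} f = Σ (Hom X Y) (Sum f)

  field
    Sum-precomp : {X Y Z : Obj} {B : Set} → Countable B →
                  (g : B → Hom Y Z) (f : Hom X Y) (m : Hom Y Z) →
                  Sum g m → Sum (λ b → g b ∘ f) (m ∘ f)
    Sum-postcomp : {X Y Z : Obj} {A : Set} → Countable A →
                   (h : Hom Y Z) (f : A → Hom X Y) (m : Hom X Y) →
                   Sum f m → Sum (λ a → h ∘ f a) (h ∘ m)

record SummabilityStructure {o ℓ} {C : Category o ℓ} (SA : SigmaAdditive C)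
       : Set (lsuc lzero ⊔ o ⊔ ℓ) where
  open Category C
  open SigmaAdditive SA
  field
    S : Obj → Obj
    π : {X : Obj} → ℕ → Hom (S X) X
    π-jointly-monic : {Z Y : Obj} (f g : Hom Z (S Y)) →
                      ((i : ℕ) → π i ∘ f ≡ π i ∘ g) → f ≡ g
    summable⇒witness : {X Y : Obj} (f : ℕ → Hom X Y) → Summable f →
                       Σ (Hom X (S Y)) (λ w → (i : ℕ) → π i ∘ w ≡ f i)
    witness⇒summable : {X Y : Obj} (f : ℕ → Hom X Y) →
                       Σ (Hom X (S Y)) (λ w → (i : ℕ) → π i ∘ w ≡ f i) →
                       Summable f
    summable-via-π : {X Y : Obj} {A : Set} → Countable A → (f : A → Hom X (S Y)) →
                     Summable (λ (p : ℕ × A) → π (proj₁ p) ∘ f (proj₂ p)) →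
                     Summable f

  witness : {X Y : Obj} (f : ℕ → Hom X Y) → Summable f → Hom X (S Y)
  witness f s = proj₁ (summable⇒witness f s)

  π-summable : {X : Obj} → Summable (π {X})
  π-summable = witness⇒summable π (id , λ i → identityʳ (π i))

  Smor : {X Y : Obj} → Hom X Y → Hom (S X) (S Y)
  Smor h = witness (λ i → h ∘ π i)
    (h ∘ proj₁ π-summable ,
     Sum-postcomp ℕ-countable h π (proj₁ π-summable) (proj₂ π-summable))

-- Products indexed by the sets of a fixed class, presented as a
-- universe: index sets are El I for I : Idx.

record Products {o ℓ} (C : Category o ℓ) {ι : Level} (Idx : Set ι) (El : Idx → Set)
       : Set (o ⊔ ℓ ⊔ ι) where
  open Category C
  field
    Π& : (I : Idx) → (El I → Obj) → Obj
    proj : {I : Idx} {X : El I → Obj} (i : El I) → Hom (Π& I X) (X i)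
    tuple : {I : Idx} {X : El I → Obj} {Z : Obj} →
            ((i : El I) → Hom Z (X i)) → Hom Z (Π& I X)
    proj-tuple : {I : Idx} {X : El I → Obj} {Z : Obj}
                 (f : (i : El I) → Hom Z (X i)) (i : El I) →
                 proj i ∘ tuple f ≡ f i
    tuple-unique : {I : Idx} {X : El I → Obj} {Z : Obj}
                   (f : (i : El I) → Hom Z (X i)) (g : Hom Z (Π& I X)) →
                   ((i : El I) → proj i ∘ g ≡ f i) → g ≡ tuple f

  &map : {I : Idx} {X Y : El I → Obj} →
         ((i : El I) → Hom (X i) (Y i)) → Hom (Π& I X) (Π& I Y)
  &map f = tuple (λ i → f i ∘ proj i)

module _ {o ℓ ι} {C : Category o ℓ} {SA : SigmaAdditive C}
         (SS : SummabilityStructure SA)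
         {Idx : Set ι} {El : Idx → Set} (P : Products C Idx El) where
  open Category C
  open SummabilityStructure SS
  open Products P

  φ : (I : Idx) (X : El I → Obj) → Hom (S (Π& I X)) (Π& I (λ i → S (X i)))
  φ I X = tuple (λ i → Smor (proj i))

  &π : (I : Idx) (X : El I → Obj) → ℕ → Hom (Π& I (λ i → S (X i))) (Π& I X)
  &π I X j = &map (λ i → π j)

-- Since the components of φ are the S p_i and π is natural, &π_j ∘ φ = π_j.
-- Joint monicity of (π_j)_j then gives w ∘ φ = id for a witness w of
-- (&π_j)_j, and joint monicity of the projections together with that of
-- (π_j)_j gives φ ∘ w = id.  Conversely, if φ ∘ ψ = id then
-- π_j ∘ ψ = &π_j ∘ φ ∘ ψ = &π_j, so any inverse of φ witnesses (&π_j)_j.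
module Submission where

open import Defs
open import Level using (Level)
open import Data.Nat using (ℕ)
open import Data.Product using (_×_; _,_; proj₁; proj₂)
open import Relation.Binary.PropositionalEquality
  using (_≡_; refl; sym; trans; cong; module ≡-Reasoning)

module ProductsProperties {o ℓ ι} {C : Category o ℓ}
    {Idx : Set ι} {El : Idx → Set} (P : Products C Idx El) where
  open Category C
  open Products P

  proj-jointly-monic : {I : Idx} {X : El I → Obj} {Z : Obj} (f g : Hom Z (Π& I X)) →
                       ((i : El I) → proj i ∘ f ≡ proj i ∘ g) → f ≡ g
  proj-jointly-monic f g eq =
    trans (tuple-unique (λ i → proj i ∘ g) f eq)
          (sym (tuple-unique (λ i → proj i ∘ g) g (λ _ → refl)))

  proj-&map : {I : Idx} {X Y : El I → Obj} (f : (i : El I) → Hom (X i) (Y i))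
              (i : El I) → proj i ∘ &map f ≡ f i ∘ proj i
  proj-&map f = proj-tuple (λ i → f i ∘ proj i)

module SummabilityProperties {o ℓ} {C : Category o ℓ} {SA : SigmaAdditive C}
    (SS : SummabilityStructure SA) where
  open Category C
  open SigmaAdditive SA
  open SummabilityStructure SS

  π-Smor : {X Y : Obj} (h : Hom X Y) (j : ℕ) → π j ∘ Smor h ≡ h ∘ π j
  π-Smor h = proj₂ (summable⇒witness (λ i → h ∘ π i)
    (h ∘ proj₁ π-summable ,
     Sum-postcomp ℕ-countable h π (proj₁ π-summable) (proj₂ π-summable)))

module ComparisonProperties {o ℓ ι} {C : Category o ℓ} {SA : SigmaAdditive C}
    (SS : SummabilityStructure SA)
    {Idx : Set ι} {El : Idx → Set} (P : Products C Idx El)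
    (I : Idx) (X : El I → Category.Obj C) where
  open Category C
  open SummabilityStructure SS
  open Products P
  open ProductsProperties P
  open SummabilityProperties SS
  open ≡-Reasoning

  proj-φ : (i : El I) → proj i ∘ φ SS P I X ≡ Smor (proj i)
  proj-φ = proj-tuple (λ i → Smor (proj i))

  &π-φ : (j : ℕ) → &π SS P I X j ∘ φ SS P I X ≡ π j
  &π-φ j = proj-jointly-monic _ _ λ i → begin
    proj i ∘ (&π SS P I X j ∘ φ SS P I X)  ≡⟨ sym (assoc _ _ _) ⟩
    (proj i ∘ &π SS P I X j) ∘ φ SS P I X  ≡⟨ cong (_∘ φ SS P I X) (proj-&map (λ _ → π j) i) ⟩
    (π j ∘ proj i) ∘ φ SS P I X            ≡⟨ assoc _ _ _ ⟩
    π j ∘ (proj i ∘ φ SS P I X)            ≡⟨ cong (π j ∘_) (proj-φ i) ⟩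
    π j ∘ Smor (proj i)                    ≡⟨ π-Smor (proj i) j ⟩
    proj i ∘ π j                           ∎

  module _ (w : Hom (Π& I (λ i → S (X i))) (S (Π& I X)))
           (w-witness : (j : ℕ) → π j ∘ w ≡ &π SS P I X j) where

    &π-witness-inverseˡ : w ∘ φ SS P I X ≡ id
    &π-witness-inverseˡ = π-jointly-monic _ _ λ j → begin
      π j ∘ (w ∘ φ SS P I X)      ≡⟨ sym (assoc _ _ _) ⟩
      (π j ∘ w) ∘ φ SS P I X      ≡⟨ cong (_∘ φ SS P I X) (w-witness j) ⟩
      &π SS P I X j ∘ φ SS P I X  ≡⟨ &π-φ j ⟩
      π j                         ≡⟨ sym (identityʳ (π j)) ⟩
      π j ∘ id                    ∎

    Smor-proj-witness : (i : El I) → Smor (proj i) ∘ w ≡ proj i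
    Smor-proj-witness i = π-jointly-monic _ _ λ j → begin
      π j ∘ (Smor (proj i) ∘ w)  ≡⟨ sym (assoc _ _ _) ⟩
      (π j ∘ Smor (proj i)) ∘ w  ≡⟨ cong (_∘ w) (π-Smor (proj i) j) ⟩
      (proj i ∘ π j) ∘ w         ≡⟨ assoc _ _ _ ⟩
      proj i ∘ (π j ∘ w)         ≡⟨ cong (proj i ∘_) (w-witness j) ⟩
      proj i ∘ &π SS P I X j     ≡⟨ proj-&map (λ _ → π j) i ⟩
      π j ∘ proj i               ∎

    &π-witness-inverseʳ : φ SS P I X ∘ w ≡ id
    &π-witness-inverseʳ = proj-jointly-monic _ _ λ i → begin
      proj i ∘ (φ SS P I X ∘ w)  ≡⟨ sym (assoc _ _ _) ⟩
      (proj i ∘ φ SS P I X) ∘ w  ≡⟨ cong (_∘ w) (proj-φ i) ⟩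
      Smor (proj i) ∘ w          ≡⟨ Smor-proj-witness i ⟩
      proj i                     ≡⟨ sym (identityʳ (proj i)) ⟩
      proj i ∘ id                ∎

    &π-witness-inverse : (w ∘ φ SS P I X ≡ id) × (φ SS P I X ∘ w ≡ id)
    &π-witness-inverse = &π-witness-inverseˡ , &π-witness-inverseʳ

  φ-sectionʳ⇒&π-witness : (ψ : Hom (Π& I (λ i → S (X i))) (S (Π& I X))) →
                          φ SS P I X ∘ ψ ≡ id → (j : ℕ) → π j ∘ ψ ≡ &π SS P I X j
  φ-sectionʳ⇒&π-witness ψ φψ≡id j = begin
    π j ∘ ψ                                ≡⟨ cong (_∘ ψ) (sym (&π-φ j)) ⟩
    (&π SS P I X j ∘ φ SS P I X) ∘ ψ       ≡⟨ assoc _ _ _ ⟩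
    &π SS P I X j ∘ (φ SS P I X ∘ ψ)       ≡⟨ cong (&π SS P I X j ∘_) φψ≡id ⟩
    &π SS P I X j ∘ id                     ≡⟨ identityʳ _ ⟩
    &π SS P I X j                          ∎

mainTheorem15 : {o ℓ ι : Level} {C : Category o ℓ} (SA : SigmaAdditive C)
  (SS : SummabilityStructure SA)
  {Idx : Set ι} {El : Idx → Set} (P : Products C Idx El) →
  let open Category C
      open SigmaAdditive SA
      open SummabilityStructure SS
      open Products P
      Cond1 = (I : Idx) (X : El I → Obj) → Summable (&π SS P I X)
      Cond2 = (I : Idx) (X : El I → Obj) → IsIso (φ SS P I X)
  in ((Cond1 → Cond2) × (Cond2 → Cond1))
     × (Cond1 → (I : Idx) (X : El I → Obj)
          (w : Hom (Π& I (λ i → S (X i))) (S (Π& I X))) →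
          ((j : ℕ) → π j ∘ w ≡ &π SS P I X j) →
          (w ∘ φ SS P I X ≡ id) × (φ SS P I X ∘ w ≡ id))
mainTheorem15 SA SS P =
  ( (λ summable I X →
       let (w , w-witness) = summable⇒witness (&π SS P I X) (summable I X)
       in w , &π-witness-inverse I X w w-witness)
  , (λ iso I X →
       let (ψ , _ , φψ≡id) = iso I X
       in witness⇒summable (&π SS P I X) (ψ , φ-sectionʳ⇒&π-witness I X ψ φψ≡id)))
  , λ _ → &π-witness-inverse
  where
  open SummabilityStructure SS
  open ComparisonProperties SS P
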